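{- Let $k,n$ be positive integers, $X=2\mathbb{N}=\{2,4,6,\dots\}$, $\rho=(k,k,\dots,k)$ with $2n$ parts, and $s\ge0$. Then $$P_{\rho,s}^X=\binom{kn}{k,k,\dots,k}^2\binom{kn}{s}^2,$$ where the multinomial coefficient has $n$ lower entries equal to $k$.
   Context: For a composition $\rho=(\rho_1,\dots,\rho_m)$, $R(\rho)$ is the set of rearrangements of the word $1^{\rho_1}\cdots m^{\rho_m}$. For $X\subseteq\mathbb{N}$, $P_{\rho,s}^{X}$ is the number of $w\in R(\rho)$ with exactly $s$ indices $i$ such that $w_i>w_{i+1}$ and $w_i\in X$. -}

module Defs where

open import Data.Nat using (ℕ; zero; suc; _+_; _*_; _<ᵇ_; _≡ᵇ_; _%_; NonZero; _!)
open import Data.Nat.ListAction using (sum; product)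
open import Data.Nat.Properties using (_!≢0; m*n≢0)
open import Data.Nat.DivMod using (_/_)

open import Data.Bool using (Bool; true; false; _∧_; not; if_then_else_)
open import Data.List using (List; []; _∷_; map; concatMap; length; upTo; filterᵇ)
import Data.List.Properties as LP
import Data.Nat.Properties as NP

Subsetℕ : Set
Subsetℕ = ℕ → Bool

twoℕ : Subsetℕ
twoℕ zero = false
twoℕ (suc a) = (suc a % 2) ≡ᵇ 0

allWords : ℕ → ℕ → List (List ℕ)
allWords m zero = [] ∷ []
allWords m (suc L) = concatMap (λ w → map (λ i → suc i ∷ w) (upTo m)) (allWords m L)

occ : ℕ → List ℕ → ℕ
occ a [] = 0
occ a (b ∷ w) = (if a ≡ᵇ b then 1 else 0) + occ a w

content : ℕ → List ℕ → List ℕ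
content m w = map (λ i → occ (suc i) w) (upTo m)

listEqᵇ : List ℕ → List ℕ → Bool
listEqᵇ [] [] = true
listEqᵇ (a ∷ as) (b ∷ bs) = (a ≡ᵇ b) ∧ listEqᵇ as bs
listEqᵇ _ _ = false

R : List ℕ → List (List ℕ)
R ρ = filterᵇ (λ w → listEqᵇ (content (length ρ) w) ρ) (allWords (length ρ) (sum ρ))

desX : Subsetℕ → List ℕ → ℕ
desX X [] = 0
desX X (a ∷ []) = 0
desX X (a ∷ b ∷ w) = (if (b <ᵇ a) ∧ X a then 1 else 0) + desX X (b ∷ w)

P : List ℕ → ℕ → Subsetℕ → ℕ
P ρ s X = length (filterᵇ (λ w → desX X w ≡ᵇ s) (R ρ))

open import Data.Nat.Combinatorics public using (_C_)

prod!≢0 : (as : List ℕ) → NonZero (product (map _! as))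
prod!≢0 [] = _
prod!≢0 (a ∷ as) = m*n≢0 (a !) (product (map _! as)) {{a !≢0}} {{prod!≢0 as}}

multinomial : List ℕ → ℕ
multinomial as = _/_ ((sum as) !) (product (map _! as)) {{prod!≢0 as}}

-- Let L = |ρ| and f s = P^X_{ρ,s}.  Insert m copies of a new largest letter outside X into a word with
-- s X-descents so that no X-descent remains: one copy must follow each descent top, and the other m − s
-- are distributed freely over the L + 1 gaps.  Hence ∑ₛ f s · C(L + m − s, L) counts the words without
-- X-descents of content ρ extended by m, and since C(L, L) = 1 these sums determine f.  Words without
-- X-descents are counted by a product of binomials, obtained by inserting the copies of each smallest
-- letter as runs after letters outside X.  For X = 2ℕ and ρ = (k^{2n}) the product is the square of the
-- multinomial (kn + m; k, …, k, m) = M · C(kn + m, kn), with M the multinomial of the theorem, while the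
-- same computation for the two-letter content (kn, kn) gives C(kn + m, kn)².  So f is M² times the count
-- for (kn, kn), which is C(kn, s)² by a direct recursion on two-letter words.

module Submission where

open import Defs
open import Data.Nat using (ℕ; zero; suc; _+_; _*_; _∸_; _^_; _≤_; _<_; z≤n; s≤s; _<ᵇ_; _≡ᵇ_; pred; _%_; _!; NonZero)
open import Data.Nat.Properties
open import Data.Nat.DivMod using (_/_; [m+n]%n≡m%n; m*n/n≡m)
open import Data.Nat.Combinatorics using (nCk+nC[k+1]≡[n+1]C[k+1])
open import Data.Nat.ListAction using (sum; product)
open import Data.Nat.ListAction.Properties using (sum-++)
open import Data.Nat.Solver using (module +-*-Solver)
open import Data.Bool using (Bool; true; false; _∧_; not; if_then_else_)
open import Data.Bool.Properties using (∧-zeroʳ; ∧-identityʳ; not-involutive; T-≡)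
open import Function.Bundles using (Equivalence)
open import Data.List using (List; []; _∷_; [_]; map; concatMap; length; upTo; filterᵇ; _++_; replicate; applyUpTo)
open import Data.List.Properties using (map-applyUpTo; map-cong; map-++)
open import Function using (_∘_; id)
open import Data.Nat.Induction using (<-rec)
open import Relation.Binary.PropositionalEquality using (_≡_; refl; sym; trans; cong; cong₂; module ≡-Reasoning)

open +-*-Solver using (solve; _:+_; _:*_; _:=_; con)

𝟙 : Bool → ℕ
𝟙 true  = 1
𝟙 false = 0

∑< : ℕ → (ℕ → ℕ) → ℕ
∑< zero    f = 0
∑< (suc n) f = f 0 + ∑< n (f ∘ suc)

syntax ∑< n (λ i → e) = ∑[ i < n ] e

∑-cong : ∀ n {f g} → (∀ i → i < n → f i ≡ g i) → ∑< n f ≡ ∑< n g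
∑-cong zero    f≗g = refl
∑-cong (suc n) f≗g = cong₂ _+_ (f≗g 0 (s≤s z≤n)) (∑-cong n (λ i i<n → f≗g (suc i) (s≤s i<n)))

∑-≡0 : ∀ n {f} → (∀ i → i < n → f i ≡ 0) → ∑< n f ≡ 0
∑-≡0 zero    f≗0 = refl
∑-≡0 (suc n) f≗0 rewrite f≗0 0 (s≤s z≤n) = ∑-≡0 n (λ i i<n → f≗0 (suc i) (s≤s i<n))

∑-distrib-+ : ∀ n f g → ∑[ i < n ] (f i + g i) ≡ ∑< n f + ∑< n g
∑-distrib-+ zero    f g = refl
∑-distrib-+ (suc n) f g rewrite ∑-distrib-+ n (f ∘ suc) (g ∘ suc) =
  solve 4 (λ a b c d → (a :+ b) :+ (c :+ d) := (a :+ c) :+ (b :+ d)) refl (f 0) (g 0) (∑< n (f ∘ suc)) (∑< n (g ∘ suc))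

*-distribˡ-∑ : ∀ n c f → ∑[ i < n ] (c * f i) ≡ c * ∑< n f
*-distribˡ-∑ zero    c f = sym (*-zeroʳ c)
*-distribˡ-∑ (suc n) c f rewrite *-distribˡ-∑ n c (f ∘ suc) = sym (*-distribˡ-+ c (f 0) _)

-- (f ⋆ g) m = ∑_{s ≤ m} f s * g (m ∸ s)
_⋆_ : (ℕ → ℕ) → (ℕ → ℕ) → ℕ → ℕ
(f ⋆ g) zero    = f 0 * g 0
(f ⋆ g) (suc m) = f 0 * g (suc m) + ((f ∘ suc) ⋆ g) m

⋆-congʳ : ∀ f {g g′} m → (∀ t → g t ≡ g′ t) → (f ⋆ g) m ≡ (f ⋆ g′) m
⋆-congʳ f zero    g≗g′ = cong (f 0 *_) (g≗g′ 0)
⋆-congʳ f (suc m) g≗g′ = cong₂ _+_ (cong (f 0 *_) (g≗g′ (suc m))) (⋆-congʳ (f ∘ suc) m g≗g′)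

⋆-zeroˡ : ∀ g m → ((λ _ → 0) ⋆ g) m ≡ 0
⋆-zeroˡ g zero    = refl
⋆-zeroˡ g (suc m) = ⋆-zeroˡ g m

⋆-distribʳ-+ : ∀ f f′ g m → ((λ s → f s + f′ s) ⋆ g) m ≡ (f ⋆ g) m + (f′ ⋆ g) m
⋆-distribʳ-+ f f′ g zero    = *-distribʳ-+ (g 0) (f 0) (f′ 0)
⋆-distribʳ-+ f f′ g (suc m) rewrite ⋆-distribʳ-+ (f ∘ suc) (f′ ∘ suc) g m =
  solve 5 (λ a a′ x y y′ → (a :+ a′) :* x :+ (y :+ y′) := a :* x :+ y :+ (a′ :* x :+ y′))
        refl (f 0) (f′ 0) (g (suc m)) (((f ∘ suc) ⋆ g) m) (((f′ ∘ suc) ⋆ g) m)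

⋆-distribˡ-+ : ∀ f g g′ m → (f ⋆ (λ t → g t + g′ t)) m ≡ (f ⋆ g) m + (f ⋆ g′) m
⋆-distribˡ-+ f g g′ zero    = *-distribˡ-+ (f 0) (g 0) (g′ 0)
⋆-distribˡ-+ f g g′ (suc m) rewrite ⋆-distribˡ-+ (f ∘ suc) g g′ m =
  solve 5 (λ a x x′ y y′ → a :* (x :+ x′) :+ (y :+ y′) := a :* x :+ y :+ (a :* x′ :+ y′))
        refl (f 0) (g (suc m)) (g′ (suc m)) (((f ∘ suc) ⋆ g) m) (((f ∘ suc) ⋆ g′) m)

⋆-*ˡ : ∀ c f g m → ((λ s → c * f s) ⋆ g) m ≡ c * (f ⋆ g) m
⋆-*ˡ c f g zero    = *-assoc c (f 0) (g 0)
⋆-*ˡ c f g (suc m) rewrite ⋆-*ˡ c (f ∘ suc) g m | *-assoc c (f 0) (g (suc m)) =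
  sym (*-distribˡ-+ c _ _)

⋆-∑ : ∀ n (F : ℕ → ℕ → ℕ) g m → ((λ s → ∑[ i < n ] F i s) ⋆ g) m ≡ ∑[ i < n ] (F i ⋆ g) m
⋆-∑ zero    F g m = ⋆-zeroˡ g m
⋆-∑ (suc n) F g m = trans (⋆-distribʳ-+ (F 0) _ g m) (cong ((F 0 ⋆ g) m +_) (⋆-∑ n (F ∘ suc) g m))

⋆-identityˡ : ∀ g m → ((λ s → 𝟙 (0 ≡ᵇ s)) ⋆ g) m ≡ g m
⋆-identityˡ g zero    = +-identityʳ (g 0)
⋆-identityˡ g (suc m) rewrite ⋆-zeroˡ g m = trans (+-identityʳ _) (+-identityʳ _)

shift : (ℕ → ℕ) → ℕ → ℕ
shift h zero    = 0
shift h (suc s) = h s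

⋆-shiftʳ : ∀ f g m → (f ⋆ shift g) (suc m) ≡ (f ⋆ g) m
⋆-shiftʳ f g zero    = trans (cong (f 0 * g 0 +_) (*-zeroʳ (f 1))) (+-identityʳ _)
⋆-shiftʳ f g (suc m) = cong (f 0 * g (suc m) +_) (⋆-shiftʳ (f ∘ suc) g m)

ifNonZero : ℕ → ℕ → ℕ
ifNonZero zero    x = 0
ifNonZero (suc _) x = x

shiftIf : Bool → (ℕ → ℕ) → ℕ → ℕ
shiftIf d h = if d then shift h else h

⋆-ifNonZero : ∀ c f g m → ((λ s → ifNonZero c (f s)) ⋆ g) m ≡ ifNonZero c ((f ⋆ g) m)
⋆-ifNonZero zero    f g m = ⋆-zeroˡ g m
⋆-ifNonZero (suc c) f g m = refl

shiftIf-zero : ∀ d h → shiftIf d h 0 ≡ (if d then 0 else h 0)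
shiftIf-zero true  h = refl
shiftIf-zero false h = refl

ifNonZero-cong : ∀ c {x y} → (∀ {c′} → c ≡ suc c′ → x ≡ y) → ifNonZero c x ≡ ifNonZero c y
ifNonZero-cong zero    _   = refl
ifNonZero-cong (suc c) x≡y = x≡y refl

shiftIf-cong : ∀ d {h h′} → (∀ s → h s ≡ h′ s) → ∀ s → shiftIf d h s ≡ shiftIf d h′ s
shiftIf-cong false h≗h′ s       = h≗h′ s
shiftIf-cong true  h≗h′ zero    = refl
shiftIf-cong true  h≗h′ (suc s) = h≗h′ s

⋆-exchange-top : ∀ m f f′ g → (∀ {s} → s < m → f s ≡ f′ s) →
                 (f ⋆ g) m + f′ m * g 0 ≡ (f′ ⋆ g) m + f m * g 0
⋆-exchange-top zero    f f′ g _     = +-comm (f 0 * g 0) (f′ 0 * g 0)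
⋆-exchange-top (suc m) f f′ g f≗f′ rewrite f≗f′ (s≤s z≤n) =
  trans (+-assoc (f′ 0 * g (suc m)) _ _)
        (trans (cong (f′ 0 * g (suc m) +_) (⋆-exchange-top m (f ∘ suc) (f′ ∘ suc) g (λ s<m → f≗f′ (s≤s s<m))))
               (sym (+-assoc (f′ 0 * g (suc m)) _ _)))

⋆-cancelʳ : ∀ f f′ g → g 0 ≡ 1 → (∀ m → (f ⋆ g) m ≡ (f′ ⋆ g) m) → ∀ s → f s ≡ f′ s
⋆-cancelʳ f f′ g g0≡1 f⋆g≗f′⋆g = <-rec (λ s → f s ≡ f′ s) step
  where
  times-g0 : ∀ x → x * g 0 ≡ x
  times-g0 x = trans (cong (x *_) g0≡1) (*-identityʳ x)

  step : ∀ s → (∀ {t} → t < s → f t ≡ f′ t) → f s ≡ f′ s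
  step s ih = sym (+-cancelˡ-≡ ((f ⋆ g) s) (f′ s) (f s) (begin
    (f ⋆ g) s + f′ s        ≡⟨ cong ((f ⋆ g) s +_) (times-g0 (f′ s)) ⟨
    (f ⋆ g) s + f′ s * g 0  ≡⟨ ⋆-exchange-top s f f′ g ih ⟩
    (f′ ⋆ g) s + f s * g 0  ≡⟨ cong₂ _+_ (sym (f⋆g≗f′⋆g s)) (times-g0 (f s)) ⟩
    (f ⋆ g) s + f s         ∎))
    where open ≡-Reasoning

-- Pascal's rule as the definition, so that it unfolds definitionally; see choose≡C.
choose : ℕ → ℕ → ℕ
choose n       zero    = 1
choose zero    (suc k) = 0
choose (suc n) (suc k) = choose n k + choose n (suc k)

choose-above : ∀ n k → n < k → choose n k ≡ 0
choose-above zero    (suc k) _         = refl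
choose-above (suc n) (suc k) (s≤s n<k)
  rewrite choose-above n k n<k | choose-above n (suc k) (m<n⇒m<1+n n<k) = refl

choose-diag : ∀ n → choose n n ≡ 1
choose-diag zero    = refl
choose-diag (suc n) rewrite choose-diag n | choose-above n (suc n) ≤-refl = refl

choose≡C : ∀ n k → choose n k ≡ n C k
choose≡C n       zero    = refl
choose≡C zero    (suc k) = refl
choose≡C (suc n) (suc k) =
  trans (cong₂ _+_ (choose≡C n k) (choose≡C n (suc k))) (nCk+nC[k+1]≡[n+1]C[k+1] n k)

choose-*-factorials : ∀ x y → choose (x + y) x * (x ! * y !) ≡ (x + y) !
choose-*-factorials zero    y = trans (*-identityˡ _) (*-identityˡ _)
choose-*-factorials (suc x) zero
  rewrite +-identityʳ x | choose-diag x | choose-above x (suc x) ≤-refl = trans (*-identityˡ _) (*-identityʳ _)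
choose-*-factorials (suc x) (suc y) = begin
  (choose (x + suc y) x + choose (x + suc y) (suc x)) * (suc x ! * suc y !)
    ≡⟨ *-distribʳ-+ (suc x ! * suc y !) (choose (x + suc y) x) (choose (x + suc y) (suc x)) ⟩
  choose (x + suc y) x * (suc x ! * suc y !) + choose (x + suc y) (suc x) * (suc x ! * suc y !)
    ≡⟨ cong₂ _+_ left right ⟩
  suc x * (x + suc y) ! + suc y * (x + suc y) !
    ≡⟨ *-distribʳ-+ ((x + suc y) !) (suc x) (suc y) ⟨
  (suc x + suc y) * (x + suc y) !
    ≡⟨⟩
  (suc x + suc y) !
    ∎
  where
  open ≡-Reasoning
  left : choose (x + suc y) x * (suc x ! * suc y !) ≡ suc x * (x + suc y) !
  left = trans (solve 4 (λ b u v a → b :* ((con 1 :+ a) :* u :* v) := (con 1 :+ a) :* (b :* (u :* v)))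
                        refl (choose (x + suc y) x) (x !) (suc y !) x)
               (cong (suc x *_) (choose-*-factorials x (suc y)))
  right : choose (x + suc y) (suc x) * (suc x ! * suc y !) ≡ suc y * (x + suc y) !
  right rewrite +-suc x y =
    trans (solve 4 (λ b u v a → b :* (u :* ((con 1 :+ a) :* v)) := (con 1 :+ a) :* (b :* (u :* v)))
                   refl (choose (suc x + y) (suc x)) (suc x !) (y !) y)
          (cong (suc y *_) (choose-*-factorials (suc x) y))

choose-trinomial : ∀ a b c → choose (b + (a + c)) b * choose (a + c) a ≡ choose (b + a) b * choose (b + a + c) (b + a)
choose-trinomial a b c = *-cancelʳ-≡ _ _ (a ! * b ! * c !) {{a!b!c!≢0}} (begin
  choose (b + (a + c)) b * choose (a + c) a * (a ! * b ! * c !)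
    ≡⟨ solve 5 (λ u v x y z → u :* v :* (x :* y :* z) := u :* (y :* (v :* (x :* z))))
               refl (choose (b + (a + c)) b) (choose (a + c) a) (a !) (b !) (c !) ⟩
  choose (b + (a + c)) b * (b ! * (choose (a + c) a * (a ! * c !)))
    ≡⟨ cong (λ z → choose (b + (a + c)) b * (b ! * z)) (choose-*-factorials a c) ⟩
  choose (b + (a + c)) b * (b ! * (a + c) !)
    ≡⟨ choose-*-factorials b (a + c) ⟩
  (b + (a + c)) !
    ≡⟨ cong _! (+-assoc b a c) ⟨
  (b + a + c) !
    ≡⟨ choose-*-factorials (b + a) c ⟨
  choose (b + a + c) (b + a) * ((b + a) ! * c !)
    ≡⟨ cong (λ z → choose (b + a + c) (b + a) * (z * c !)) (choose-*-factorials b a) ⟨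
  choose (b + a + c) (b + a) * (choose (b + a) b * (b ! * a !) * c !)
    ≡⟨ solve 5 (λ u v x y z → u :* (v :* (y :* x) :* z) := v :* u :* (x :* y :* z))
               refl (choose (b + a + c) (b + a)) (choose (b + a) b) (a !) (b !) (c !) ⟩
  choose (b + a) b * choose (b + a + c) (b + a) * (a ! * b ! * c !)
    ∎)
  where
  open ≡-Reasoning
  a!b!c!≢0 : NonZero (a ! * b ! * c !)
  a!b!c!≢0 = m*n≢0 (a ! * b !) (c !) {{m*n≢0 (a !) (b !) {{a !≢0}} {{b !≢0}}}} {{c !≢0}}

-- The number of ways to distribute t identical letters into the L + 1 gaps of a word of length L.
insertions : ℕ → ℕ → ℕ
insertions L t = choose (t + L) L

insertions-zero : ∀ L → insertions L 0 ≡ 1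
insertions-zero = choose-diag

insertions-pascal : ∀ L t → insertions (suc L) t ≡ insertions L t + shift (insertions (suc L)) t
insertions-pascal L zero    rewrite choose-diag L | choose-above L (suc L) ≤-refl = refl
insertions-pascal L (suc t) = cong (λ z → choose z L + choose (t + suc L) (suc L)) (+-suc t L)

⋆-insertions-zero : ∀ f L → (f ⋆ insertions L) 0 ≡ f 0
⋆-insertions-zero f L = trans (cong (f 0 *_) (insertions-zero L)) (*-identityʳ (f 0))

⋆-insertions-suc : ∀ f L m → (f ⋆ insertions (suc L)) (suc m) ≡ (f ⋆ insertions L) (suc m) + (f ⋆ insertions (suc L)) m
⋆-insertions-suc f L m = begin
  (f ⋆ insertions (suc L)) (suc m)                                   ≡⟨ ⋆-congʳ f (suc m) (insertions-pascal L) ⟩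
  (f ⋆ (λ t → insertions L t + shift (insertions (suc L)) t)) (suc m)  ≡⟨ ⋆-distribˡ-+ f (insertions L) _ (suc m) ⟩
  (f ⋆ insertions L) (suc m) + (f ⋆ shift (insertions (suc L))) (suc m) ≡⟨ cong ((f ⋆ insertions L) (suc m) +_) (⋆-shiftʳ f _ m) ⟩
  (f ⋆ insertions L) (suc m) + (f ⋆ insertions (suc L)) m            ∎
  where open ≡-Reasoning

sum-map-0 : ∀ {A : Set} (ws : List A) → sum (map (λ _ → 0) ws) ≡ 0
sum-map-0 []       = refl
sum-map-0 (w ∷ ws) = sum-map-0 ws

sum-map-concatMap : ∀ {A B : Set} (f : B → ℕ) (g : A → List B) ws →
                    sum (map f (concatMap g ws)) ≡ sum (map (λ w → sum (map f (g w))) ws)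
sum-map-concatMap f g []       = refl
sum-map-concatMap f g (w ∷ ws) = begin
  sum (map f (g w ++ concatMap g ws))                ≡⟨ cong sum (map-++ f (g w) (concatMap g ws)) ⟩
  sum (map f (g w) ++ map f (concatMap g ws))        ≡⟨ sum-++ (map f (g w)) _ ⟩
  sum (map f (g w)) + sum (map f (concatMap g ws))  ≡⟨ cong (sum (map f (g w)) +_) (sum-map-concatMap f g ws) ⟩
  sum (map f (g w)) + sum (map (λ w → sum (map f (g w))) ws) ∎
  where open ≡-Reasoning

sum-map-applyUpTo : ∀ {A : Set} (f : A → ℕ) g N → sum (map f (applyUpTo g N)) ≡ ∑[ i < N ] f (g i)
sum-map-applyUpTo f g zero    = refl
sum-map-applyUpTo f g (suc N) = cong (f (g 0) +_) (sum-map-applyUpTo f (g ∘ suc) N)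

sum-map-∑ : ∀ {A : Set} N (F : ℕ → A → ℕ) ws → sum (map (λ w → ∑[ i < N ] F i w) ws) ≡ ∑[ i < N ] sum (map (F i) ws)
sum-map-∑ N F []       = sym (∑-≡0 N (λ _ _ → refl))
sum-map-∑ N F (w ∷ ws) =
  trans (cong (∑[ i < N ] F i w +_) (sum-map-∑ N F ws)) (sym (∑-distrib-+ N (λ i → F i w) (λ i → sum (map (F i) ws))))

sum-map-ifNonZero-shiftIf : ∀ {A : Set} c d (F : A → ℕ → ℕ) s ws →
  sum (map (λ w → ifNonZero c (shiftIf d (F w) s)) ws) ≡ ifNonZero c (shiftIf d (λ s → sum (map (λ w → F w s) ws)) s)
sum-map-ifNonZero-shiftIf zero    d     F s       ws = sum-map-0 ws
sum-map-ifNonZero-shiftIf (suc c) false F s       ws = refl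
sum-map-ifNonZero-shiftIf (suc c) true  F zero    ws = sum-map-0 ws
sum-map-ifNonZero-shiftIf (suc c) true  F (suc s) ws = refl

length-filterᵇ-filterᵇ : ∀ {A : Set} (q r : A → Bool) ws →
                         length (filterᵇ q (filterᵇ r ws)) ≡ sum (map (λ w → 𝟙 (r w ∧ q w)) ws)
length-filterᵇ-filterᵇ q r [] = refl
length-filterᵇ-filterᵇ q r (w ∷ ws) with r w
... | false = length-filterᵇ-filterᵇ q r ws
... | true with q w
...   | true  = cong suc (length-filterᵇ-filterᵇ q r ws)
...   | false = length-filterᵇ-filterᵇ q r ws

multAt : ℕ → List ℕ → ℕ
multAt i       []       = 0
multAt zero    (c ∷ cs) = c
multAt (suc i) (c ∷ cs) = multAt i cs

decAt : ℕ → List ℕ → List ℕ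
decAt i       []       = []
decAt zero    (c ∷ cs) = pred c ∷ cs
decAt (suc i) (c ∷ cs) = c ∷ decAt i cs

length-decAt : ∀ i cs → length (decAt i cs) ≡ length cs
length-decAt i       []       = refl
length-decAt zero    (c ∷ cs) = refl
length-decAt (suc i) (c ∷ cs) = cong suc (length-decAt i cs)

sum-decAt : ∀ i cs {c} → multAt i cs ≡ suc c → suc (sum (decAt i cs)) ≡ sum cs
sum-decAt zero    (suc c ∷ cs) _  = refl
sum-decAt (suc i) (c ∷ cs)     eq = trans (sym (+-suc c _)) (cong (c +_) (sum-decAt i cs eq))

multAt-≡0 : ∀ i cs → sum cs ≡ 0 → multAt i cs ≡ 0
multAt-≡0 i       []           _  = refl
multAt-≡0 zero    (zero ∷ cs) _  = refl
multAt-≡0 (suc i) (zero ∷ cs) eq = multAt-≡0 i cs eq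

∑-entries-∷ʳ : ∀ (F : ℕ → ℕ → List ℕ → ℕ) cs x →
  ∑[ i < length (cs ++ [ x ]) ] F (suc i) (multAt i (cs ++ [ x ])) (decAt i (cs ++ [ x ]))
  ≡ ∑[ i < length cs ] F (suc i) (multAt i cs) (decAt i cs ++ [ x ]) + F (suc (length cs)) x (cs ++ [ pred x ])
∑-entries-∷ʳ F []       x = +-identityʳ _
∑-entries-∷ʳ F (c ∷ cs) x =
  trans (cong (F 1 c (pred c ∷ cs ++ [ x ]) +_) (∑-entries-∷ʳ (λ ℓ m ds → F (suc ℓ) m (c ∷ ds)) cs x))
        (sym (+-assoc (F 1 c (pred c ∷ cs ++ [ x ])) _ _))

listEqᵇ-addUnit : ∀ N i cs f → length cs ≡ N → i < N →
                  listEqᵇ (applyUpTo (λ j → (if j ≡ᵇ i then 1 else 0) + f j) N) cs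
                  ≡ (0 <ᵇ multAt i cs) ∧ listEqᵇ (applyUpTo f N) (decAt i cs)
listEqᵇ-addUnit (suc N) zero    (zero ∷ cs)  f _  _ = refl
listEqᵇ-addUnit (suc N) zero    (suc c ∷ cs) f _  _ = refl
listEqᵇ-addUnit (suc N) (suc i) (c ∷ cs)     f eq (s≤s i<N)
  rewrite listEqᵇ-addUnit N i cs (f ∘ suc) (suc-injective eq) i<N
  with f 0 ≡ᵇ c | 0 <ᵇ multAt i cs
... | true  | _     = refl
... | false | true  = refl
... | false | false = refl

listEqᵇ-zeros : ∀ N cs → length cs ≡ N → sum cs ≡ 0 → listEqᵇ (applyUpTo (λ _ → 0) N) cs ≡ true
listEqᵇ-zeros zero    []          _  _  = refl
listEqᵇ-zeros (suc N) (zero ∷ cs) eq Σ≡0 = listEqᵇ-zeros N cs (suc-injective eq) Σ≡0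

content≡applyUpTo : ∀ N w → content N w ≡ applyUpTo (λ j → occ (suc j) w) N
content≡applyUpTo N w = map-applyUpTo id (λ j → occ (suc j) w) N

≤⇒≮ᵇ : ∀ {m n} → n ≤ m → (m <ᵇ n) ≡ false
≤⇒≮ᵇ z≤n       = refl
≤⇒≮ᵇ (s≤s n≤m) = ≤⇒≮ᵇ n≤m

-- letter a i = a + i, with an accumulator so that letter a (suc i) and letter (suc a) i agree definitionally.
letter : ℕ → ℕ → ℕ
letter a zero    = a
letter a (suc i) = letter (suc a) i

letter≡+ : ∀ a i → letter a i ≡ a + i
letter≡+ a zero    = sym (+-identityʳ a)
letter≡+ a (suc i) = trans (letter≡+ (suc a) i) (sym (+-suc a i))

<ᵇ-letter : ∀ a i → (a <ᵇ letter (suc a) i) ≡ true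
<ᵇ-letter a i rewrite letter≡+ (suc a) i = Equivalence.to T-≡ (<⇒<ᵇ (s≤s (m≤m+n a i)))

-- Counting words by their first letter

module _ (X : Subsetℕ) where

  isDescent : ℕ → ℕ → Bool
  isDescent p ℓ = (ℓ <ᵇ p) ∧ X p

  -- countWords n cs p s counts the words with content cs (letter i + 1 occurring cs[i] times) having
  -- s X-descents when preceded by the letter p, where p = 0 precedes nothing.  The length n is fuel:
  -- it is always sum cs.
  countWords : ℕ → List ℕ → ℕ → ℕ → ℕ
  countWords zero    cs p s = 𝟙 (0 ≡ᵇ s)
  countWords (suc n) cs p s =
    ∑[ i < length cs ] ifNonZero (multAt i cs) (shiftIf (isDescent p (suc i)) (countWords n (decAt i cs) (suc i)) s)

  matches : ℕ → List ℕ → ℕ → ℕ → List ℕ → ℕ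
  matches N cs p s w = 𝟙 (listEqᵇ (content N w) cs ∧ (desX X (p ∷ w) ≡ᵇ s))

  matches-∷ : ∀ N i cs p s w → length cs ≡ N → i < N →
              matches N cs p s (suc i ∷ w)
              ≡ ifNonZero (multAt i cs) (shiftIf (isDescent p (suc i)) (λ s → matches N (decAt i cs) (suc i) s w) s)
  matches-∷ N i cs p s w eq i<N
    rewrite content≡applyUpTo N (suc i ∷ w) | content≡applyUpTo N w
          | listEqᵇ-addUnit N i cs (λ j → occ (suc j) w) eq i<N
    with multAt i cs | isDescent p (suc i) | s
  ... | zero  | _     | _     = refl
  ... | suc _ | false | _     = refl
  ... | suc _ | true  | suc _ = refl
  ... | suc _ | true  | zero  with listEqᵇ (applyUpTo (λ j → occ (suc j) w) N) (decAt i cs)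
  ...   | true  = refl
  ...   | false = refl

  enumerated : ℕ → ℕ → List ℕ → ℕ → ℕ → ℕ
  enumerated N L cs p s = sum (map (matches N cs p s) (allWords N L))

  enumerated≡countWords : ∀ L N cs p s → length cs ≡ N → sum cs ≡ L → enumerated N L cs p s ≡ countWords L cs p s
  enumerated≡countWords zero N cs p s len Σ≡0
    rewrite content≡applyUpTo N [] | listEqᵇ-zeros N cs len Σ≡0 with s
  ... | zero  = refl
  ... | suc _ = refl
  enumerated≡countWords (suc L) N cs p s len Σ≡ = begin
    sum (map Q (concatMap (λ w → map (λ i → suc i ∷ w) (upTo N)) (allWords N L)))
      ≡⟨ sum-map-concatMap Q (λ w → map (λ i → suc i ∷ w) (upTo N)) (allWords N L) ⟩
    sum (map (λ w → sum (map Q (map (λ i → suc i ∷ w) (upTo N)))) (allWords N L))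
      ≡⟨ cong sum (map-cong extend (allWords N L)) ⟩
    sum (map (λ w → ∑[ i < N ] Q (suc i ∷ w)) (allWords N L))
      ≡⟨ sum-map-∑ N (λ i w → Q (suc i ∷ w)) (allWords N L) ⟩
    ∑[ i < N ] sum (map (λ w → Q (suc i ∷ w)) (allWords N L))
      ≡⟨ ∑-cong N firstLetter ⟩
    ∑[ i < N ] ifNonZero (multAt i cs) (shiftIf (isDescent p (suc i)) (countWords L (decAt i cs) (suc i)) s)
      ≡⟨ cong (λ n → ∑[ i < n ] _) len ⟨
    countWords (suc L) cs p s
      ∎
    where
    open ≡-Reasoning
    Q : List ℕ → ℕ
    Q = matches N cs p s

    extend : ∀ w → sum (map Q (map (λ i → suc i ∷ w) (upTo N))) ≡ ∑[ i < N ] Q (suc i ∷ w)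
    extend w = trans (cong (sum ∘ map Q) (map-applyUpTo id (λ i → suc i ∷ w) N))
                     (sum-map-applyUpTo Q (λ i → suc i ∷ w) N)

    firstLetter : ∀ i → i < N → sum (map (λ w → Q (suc i ∷ w)) (allWords N L))
                  ≡ ifNonZero (multAt i cs) (shiftIf (isDescent p (suc i)) (countWords L (decAt i cs) (suc i)) s)
    firstLetter i i<N = begin
      sum (map (λ w → Q (suc i ∷ w)) (allWords N L))
        ≡⟨ cong sum (map-cong (λ w → matches-∷ N i cs p s w len i<N) (allWords N L)) ⟩
      sum (map (λ w → ifNonZero (multAt i cs) (shiftIf (isDescent p (suc i)) (λ s → matches N (decAt i cs) (suc i) s w) s)) (allWords N L))
        ≡⟨ sum-map-ifNonZero-shiftIf (multAt i cs) (isDescent p (suc i)) (λ w s → matches N (decAt i cs) (suc i) s w) s (allWords N L) ⟩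
      ifNonZero (multAt i cs) (shiftIf (isDescent p (suc i)) (λ s → enumerated N L (decAt i cs) (suc i) s) s)
        ≡⟨ ifNonZero-cong (multAt i cs) (λ mᵢ≡ → shiftIf-cong (isDescent p (suc i)) (λ s →
             enumerated≡countWords L N (decAt i cs) (suc i) s (trans (length-decAt i cs) len)
                                   (suc-injective (trans (sum-decAt i cs mᵢ≡) Σ≡))) s) ⟩
      ifNonZero (multAt i cs) (shiftIf (isDescent p (suc i)) (countWords L (decAt i cs) (suc i)) s)
        ∎

  desX-0∷ : ∀ w → desX X (0 ∷ w) ≡ desX X w
  desX-0∷ []      = refl
  desX-0∷ (_ ∷ _) = refl

  P≡countWords : ∀ ρ s → P ρ s X ≡ countWords (sum ρ) ρ 0 s
  P≡countWords ρ s = begin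
    length (filterᵇ (λ w → desX X w ≡ᵇ s) (filterᵇ (λ w → listEqᵇ (content N w) ρ) (allWords N (sum ρ))))
      ≡⟨ length-filterᵇ-filterᵇ _ _ (allWords N (sum ρ)) ⟩
    sum (map (λ w → 𝟙 (listEqᵇ (content N w) ρ ∧ (desX X w ≡ᵇ s))) (allWords N (sum ρ)))
      ≡⟨ cong sum (map-cong (λ w → cong (λ d → 𝟙 (listEqᵇ (content N w) ρ ∧ (d ≡ᵇ s))) (desX-0∷ w)) (allWords N (sum ρ))) ⟨
    enumerated N (sum ρ) ρ 0 s
      ≡⟨ enumerated≡countWords (sum ρ) N ρ 0 s refl refl ⟩
    countWords (sum ρ) ρ 0 s
      ∎
    where
    open ≡-Reasoning
    N = length ρ

  -- Words without X-descents

  lettersOutsideX : ℕ → List ℕ → ℕ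
  lettersOutsideX a []       = 0
  lettersOutsideX a (c ∷ cs) = (if X a then 0 else c) + lettersOutsideX (suc a) cs

  -- Here the first entry of cs is the multiplicity of the letter a.  Deleting the copies of the smallest
  -- letter a from a word without X-descents leaves such a word; they come back as runs, each at the
  -- start (unless p → a is an X-descent) or right after a letter not in X, i.e. as a multiset of
  -- size c on that many gaps.
  noDescentCount : ℕ → List ℕ → ℕ → ℕ
  noDescentCount a []       p = 1
  noDescentCount a (c ∷ cs) p = choose (c + lettersOutsideX (suc a) cs ∸ 𝟙 (isDescent p a)) c * noDescentCount (suc a) cs p

  lettersOutsideX-≡0 : ∀ a cs → sum cs ≡ 0 → lettersOutsideX a cs ≡ 0
  lettersOutsideX-≡0 a []          _  = refl
  lettersOutsideX-≡0 a (zero ∷ cs) Σ≡0 rewrite lettersOutsideX-≡0 (suc a) cs Σ≡0 with X a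
  ... | true  = refl
  ... | false = refl

  noDescentCount-≡1 : ∀ a cs p → sum cs ≡ 0 → noDescentCount a cs p ≡ 1
  noDescentCount-≡1 a []          p _   = refl
  noDescentCount-≡1 a (zero ∷ cs) p Σ≡0 rewrite noDescentCount-≡1 (suc a) cs p Σ≡0 = refl

  isDescent-up : ∀ p {ℓ} → p ≤ ℓ → isDescent p ℓ ≡ false
  isDescent-up p p≤ℓ rewrite ≤⇒≮ᵇ p≤ℓ = refl

  isDescent-mono : ∀ p {a b} → isDescent p a ≡ false → a ≤ b → isDescent p b ≡ false
  isDescent-mono p {a} {b} p↛a a≤b with X p
  ... | false = ∧-zeroʳ (b <ᵇ p)
  ... | true  = trans (∧-identityʳ (b <ᵇ p)) (<ᵇ-mono p (trans (sym (∧-identityʳ (a <ᵇ p))) p↛a) a≤b)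
    where
    <ᵇ-mono : ∀ p {a b} → (a <ᵇ p) ≡ false → a ≤ b → (b <ᵇ p) ≡ false
    <ᵇ-mono zero    _  _         = refl
    <ᵇ-mono (suc p) {suc a} {suc b} a≮p (s≤s a≤b) = <ᵇ-mono p a≮p a≤b

  noDescentCount-unconstrained : ∀ a cs q → (∀ {ℓ} → a ≤ ℓ → isDescent q ℓ ≡ false) →
                                 noDescentCount a cs q ≡ noDescentCount a cs 0
  noDescentCount-unconstrained a []       q _     = refl
  noDescentCount-unconstrained a (c ∷ cs) q q↛ rewrite q↛ ≤-refl
    | noDescentCount-unconstrained (suc a) cs q (λ a<ℓ → q↛ (<⇒≤ a<ℓ)) = refl

  lettersOutsideX-decAt : ∀ a i cs {x} → multAt i cs ≡ suc x →
                   lettersOutsideX a (decAt i cs) + 𝟙 (not (X (letter a i))) ≡ lettersOutsideX a cs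
  lettersOutsideX-decAt a zero    (suc y ∷ cs) _ with X a
  ... | true  = +-identityʳ _
  ... | false = +-comm _ 1
  lettersOutsideX-decAt a (suc i) (y ∷ cs)     eq =
    trans (+-assoc (if X a then 0 else y) _ _) (cong ((if X a then 0 else y) +_) (lettersOutsideX-decAt (suc a) i cs eq))

  -- Removing one copy of a letter ℓ > a either removes an lettersOutsideX letter or makes ℓ → a an X-descent.
  gaps-decAt : ∀ a i cs c {x} → multAt i cs ≡ suc x →
               suc c + lettersOutsideX (suc a) (decAt i cs) ∸ 𝟙 (isDescent (letter (suc a) i) a) ≡ c + lettersOutsideX (suc a) cs
  gaps-decAt a i cs c eq rewrite <ᵇ-letter a i | sym (lettersOutsideX-decAt (suc a) i cs eq) with X (letter (suc a) i)
  ... | true  = cong (c +_) (sym (+-identityʳ _))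
  ... | false = sym (trans (cong (c +_) (+-comm _ 1)) (+-suc c _))

  byFirstLetter : ℕ → List ℕ → ℕ → ℕ
  byFirstLetter a cs p =
    ∑[ i < length cs ] ifNonZero (multAt i cs) (if isDescent p (letter a i) then 0 else noDescentCount a (decAt i cs) (letter a i))

  byFirstLetter-≡0 : ∀ a cs p → sum cs ≡ 0 → byFirstLetter a cs p ≡ 0
  byFirstLetter-≡0 a cs p Σ≡0 = ∑-≡0 (length cs) (λ i _ →
    cong (λ m → ifNonZero m (if isDescent p (letter a i) then 0 else noDescentCount a (decAt i cs) (letter a i))) (multAt-≡0 i cs Σ≡0))

  byFirstLetter-laterLetters : ∀ a c cs p →
    (∀ {n} → sum cs ≡ suc n → noDescentCount (suc a) cs p ≡ byFirstLetter (suc a) cs p) →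
    ∑[ i < length cs ] ifNonZero (multAt i cs)
      (if isDescent p (letter (suc a) i) then 0 else noDescentCount a (suc c ∷ decAt i cs) (letter (suc a) i))
    ≡ choose (c + lettersOutsideX (suc a) cs) (suc c) * noDescentCount (suc a) cs p
  byFirstLetter-laterLetters a c cs p IH = begin
    ∑[ i < length cs ] ifNonZero (multAt i cs)
      (if isDescent p (letter (suc a) i) then 0 else noDescentCount a (suc c ∷ decAt i cs) (letter (suc a) i))
      ≡⟨ ∑-cong (length cs) factor ⟩
    ∑[ i < length cs ] (k * ifNonZero (multAt i cs)
      (if isDescent p (letter (suc a) i) then 0 else noDescentCount (suc a) (decAt i cs) (letter (suc a) i)))
      ≡⟨ *-distribˡ-∑ (length cs) k _ ⟩
    k * byFirstLetter (suc a) cs p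
      ≡⟨ laterCount ⟩
    k * noDescentCount (suc a) cs p
      ∎
    where
    open ≡-Reasoning
    k = choose (c + lettersOutsideX (suc a) cs) (suc c)

    factor : ∀ i → i < length cs →
             ifNonZero (multAt i cs) (if isDescent p (letter (suc a) i) then 0 else noDescentCount a (suc c ∷ decAt i cs) (letter (suc a) i))
             ≡ k * ifNonZero (multAt i cs) (if isDescent p (letter (suc a) i) then 0 else noDescentCount (suc a) (decAt i cs) (letter (suc a) i))
    factor i _ with multAt i cs in mᵢ≡
    ... | zero  = sym (*-zeroʳ k)
    ... | suc _ rewrite gaps-decAt a i cs c mᵢ≡ with isDescent p (letter (suc a) i)
    ...   | true  = sym (*-zeroʳ k)
    ...   | false = refl

    laterCount : k * byFirstLetter (suc a) cs p ≡ k * noDescentCount (suc a) cs p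
    laterCount = bySum (sum cs) refl
      where
      bySum : ∀ t → sum cs ≡ t → k * byFirstLetter (suc a) cs p ≡ k * noDescentCount (suc a) cs p
      bySum (suc _) Σcs = cong (k *_) (sym (IH Σcs))
      bySum zero    Σcs rewrite byFirstLetter-≡0 (suc a) cs p Σcs | noDescentCount-≡1 (suc a) cs p Σcs
                              | lettersOutsideX-≡0 (suc a) cs Σcs | +-identityʳ c | choose-above c (suc c) ≤-refl = refl

  noDescentCount≡byFirstLetter : ∀ a cs p {n} → sum cs ≡ suc n → noDescentCount a cs p ≡ byFirstLetter a cs p
  noDescentCount≡byFirstLetter a (zero ∷ cs) p Σ≡ = trans (+-identityʳ _) (trans
    (noDescentCount≡byFirstLetter (suc a) cs p Σ≡)
    (∑-cong (length cs) (λ i _ → cong (λ z → ifNonZero (multAt i cs) (if isDescent p (letter (suc a) i) then 0 else z))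
                                       (sym (+-identityʳ _)))))
  noDescentCount≡byFirstLetter a (suc c ∷ cs) p Σ≡ = begin
    choose (suc c + U ∸ 𝟙 (isDescent p a)) (suc c) * D p
      ≡⟨ pascal (isDescent p a) refl ⟩
    (if isDescent p a then 0 else choose (c + U) c * D 0) + choose (c + U) (suc c) * D p
      ≡⟨ cong₂ _+_ (cong (λ x → if isDescent p a then 0 else x) (sym first))
                   (sym (byFirstLetter-laterLetters a c cs p (noDescentCount≡byFirstLetter (suc a) cs p))) ⟩
    byFirstLetter a (suc c ∷ cs) p
      ∎
    where
    open ≡-Reasoning
    U = lettersOutsideX (suc a) cs
    D = noDescentCount (suc a) cs

    pascal : ∀ d → isDescent p a ≡ d →
             choose (suc c + U ∸ 𝟙 d) (suc c) * D p ≡ (if d then 0 else choose (c + U) c * D 0) + choose (c + U) (suc c) * D p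
    pascal true  _   = refl
    pascal false p↛a
      rewrite noDescentCount-unconstrained (suc a) cs p (λ a<ℓ → isDescent-mono p p↛a (<⇒≤ a<ℓ)) =
      *-distribʳ-+ (D 0) (choose (c + U) c) (choose (c + U) (suc c))

    first : noDescentCount a (c ∷ cs) a ≡ choose (c + U) c * D 0
    first rewrite isDescent-up a ≤-refl | noDescentCount-unconstrained (suc a) cs a (isDescent-up a ∘ <⇒≤) = refl

  countWords≡noDescentCount : ∀ n cs p → sum cs ≡ n → countWords n cs p 0 ≡ noDescentCount 1 cs p
  countWords≡noDescentCount zero    cs p Σ≡0 = sym (noDescentCount-≡1 1 cs p Σ≡0)
  countWords≡noDescentCount (suc n) cs p Σ≡  = trans (∑-cong (length cs) firstLetter) (sym (noDescentCount≡byFirstLetter 1 cs p Σ≡))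
    where
    firstLetter : ∀ i → i < length cs →
                  ifNonZero (multAt i cs) (shiftIf (isDescent p (suc i)) (countWords n (decAt i cs) (suc i)) 0)
                  ≡ ifNonZero (multAt i cs) (if isDescent p (letter 1 i) then 0 else noDescentCount 1 (decAt i cs) (letter 1 i))
    firstLetter i _ rewrite letter≡+ 1 i = ifNonZero-cong (multAt i cs) λ mᵢ≡ →
      trans (shiftIf-zero (isDescent p (suc i)) _)
            (cong (λ x → if isDescent p (suc i) then 0 else x)
                  (countWords≡noDescentCount n (decAt i cs) (suc i) (suc-injective (trans (sum-decAt i cs mᵢ≡) Σ≡))))

  -- Inserting a new largest letter outside X

  countWords-startOutsideX : ∀ n cs q s → X q ≡ false → countWords n cs q s ≡ countWords n cs 0 s
  countWords-startOutsideX zero    cs q s _    = refl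
  countWords-startOutsideX (suc n) cs q s q∉X = ∑-cong (length cs) (λ i _ →
    cong (λ d → ifNonZero (multAt i cs) (shiftIf d (countWords n (decAt i cs) (suc i)) s))
         (trans (cong ((suc i <ᵇ q) ∧_) q∉X) (∧-zeroʳ _)))

  countWords-∷ʳ : ∀ n cs x q s → countWords (suc n) (cs ++ [ x ]) q s
    ≡ ∑[ i < length cs ] ifNonZero (multAt i cs) (shiftIf (isDescent q (suc i)) (countWords n (decAt i cs ++ [ x ]) (suc i)) s)
      + ifNonZero x (shiftIf (isDescent q (suc (length cs))) (countWords n (cs ++ [ pred x ]) (suc (length cs))) s)
  countWords-∷ʳ n cs x q s =
    ∑-entries-∷ʳ (λ ℓ m ds → ifNonZero m (shiftIf (isDescent q ℓ) (countWords n ds ℓ) s)) cs x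

  countWords-onlyNewLetter : ∀ m cs p → sum cs ≡ 0 → X (suc (length cs)) ≡ false → p ≤ length cs →
                             countWords m (cs ++ [ m ]) p 0 ≡ 1
  countWords-onlyNewLetter zero    cs p _   _      _   = refl
  countWords-onlyNewLetter (suc m) cs p Σ≡0 new∉X p≤N
    rewrite countWords-∷ʳ m cs (suc m) p 0
          | ∑-≡0 (length cs) (λ i _ →
              cong (λ c → ifNonZero c (shiftIf (isDescent p (suc i)) (countWords m (decAt i cs ++ [ suc m ]) (suc i)) 0))
                   (multAt-≡0 i cs Σ≡0))
          | isDescent-up p (m≤n⇒m≤1+n p≤N)
          | countWords-startOutsideX m (cs ++ [ m ]) (suc (length cs)) 0 new∉X
    = countWords-onlyNewLetter m cs 0 Σ≡0 new∉X z≤n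

  InsertionIdentity : ℕ → ℕ → List ℕ → ℕ → Set
  InsertionIdentity m L cs p = sum cs ≡ L → X (suc (length cs)) ≡ false → p ≤ length cs →
    (countWords L cs p ⋆ insertions L) m ≡ countWords (L + m) (cs ++ [ m ]) p 0

  countWords-⋆-unfold : ∀ L cs p m → (countWords (suc L) cs p ⋆ insertions (suc L)) m
    ≡ ∑[ i < length cs ] ifNonZero (multAt i cs) ((shiftIf (isDescent p (suc i)) (countWords L (decAt i cs) (suc i)) ⋆ insertions (suc L)) m)
  countWords-⋆-unfold L cs p m =
    trans (⋆-∑ (length cs) (λ i s → ifNonZero (multAt i cs) (shiftIf (isDescent p (suc i)) (H i) s)) (insertions (suc L)) m)
          (∑-cong (length cs) (λ i _ → ⋆-ifNonZero (multAt i cs) (shiftIf (isDescent p (suc i)) (H i)) (insertions (suc L)) m))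
    where
    H : ℕ → ℕ → ℕ
    H i = countWords L (decAt i cs) (suc i)

  module _ {L cs p} (Σ≡ : sum cs ≡ suc L) (new∉X : X (suc (length cs)) ≡ false) (p≤N : p ≤ length cs) where

    private
      N = length cs
      H : ℕ → ℕ → ℕ
      H i = countWords L (decAt i cs) (suc i)

    removalIH : ∀ m i {x} → InsertionIdentity m L (decAt i cs) (suc i) → i < N → multAt i cs ≡ suc x →
                (H i ⋆ insertions L) m ≡ countWords (L + m) (decAt i cs ++ [ m ]) (suc i) 0
    removalIH m i IH i<N mᵢ≡ rewrite sym (length-decAt i cs) =
      IH (suc-injective (trans (sum-decAt i cs mᵢ≡) Σ≡)) new∉X i<N

    insertion-step-zero : (∀ i → InsertionIdentity 0 L (decAt i cs) (suc i)) →
                          (countWords (suc L) cs p ⋆ insertions (suc L)) 0 ≡ countWords (suc L + 0) (cs ++ [ 0 ]) p 0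
    insertion-step-zero IH rewrite countWords-⋆-unfold L cs p 0 | countWords-∷ʳ (L + 0) cs 0 p 0 =
      trans (∑-cong N term) (sym (+-identityʳ _))
      where
      term : ∀ i → i < N → ifNonZero (multAt i cs) ((shiftIf (isDescent p (suc i)) (H i) ⋆ insertions (suc L)) 0)
                         ≡ ifNonZero (multAt i cs) (shiftIf (isDescent p (suc i)) (countWords (L + 0) (decAt i cs ++ [ 0 ]) (suc i)) 0)
      term i i<N with multAt i cs in mᵢ≡ | isDescent p (suc i)
      ... | zero  | _     = refl
      ... | suc _ | true  = refl
      ... | suc _ | false = begin
        (H i ⋆ insertions (suc L)) 0  ≡⟨ ⋆-insertions-zero (H i) (suc L) ⟩
        H i 0                        ≡⟨ ⋆-insertions-zero (H i) L ⟨
        (H i ⋆ insertions L) 0        ≡⟨ removalIH 0 i (IH i) i<N mᵢ≡ ⟩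
        countWords (L + 0) (decAt i cs ++ [ 0 ]) (suc i) 0 ∎
        where open ≡-Reasoning

    insertion-step-suc : ∀ m → (∀ i → InsertionIdentity (suc m) L (decAt i cs) (suc i)) → InsertionIdentity m (suc L) cs 0 →
                         (countWords (suc L) cs p ⋆ insertions (suc L)) (suc m) ≡ countWords (suc L + suc m) (cs ++ [ suc m ]) p 0
    insertion-step-suc m IH IH′ = begin
      (countWords (suc L) cs p ⋆ insertions (suc L)) (suc m)
        ≡⟨ countWords-⋆-unfold L cs p (suc m) ⟩
      ∑[ i < N ] ifNonZero (multAt i cs) ((shiftIf (isDescent p (suc i)) (H i) ⋆ insertions (suc L)) (suc m))
        ≡⟨ ∑-cong N term ⟩
      ∑[ i < N ] (G i + ifNonZero (multAt i cs) ((H i ⋆ insertions (suc L)) m))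
        ≡⟨ ∑-distrib-+ N G _ ⟩
      ∑< N G + ∑[ i < N ] ifNonZero (multAt i cs) ((H i ⋆ insertions (suc L)) m)
        ≡⟨ cong (∑< N G +_) (countWords-⋆-unfold L cs 0 m) ⟨
      ∑< N G + (countWords (suc L) cs 0 ⋆ insertions (suc L)) m
        ≡⟨ cong (∑< N G +_) (IH′ Σ≡ new∉X z≤n) ⟩
      ∑< N G + countWords (suc L + m) (cs ++ [ m ]) 0 0
        ≡⟨ cong (∑< N G +_) lastLetter ⟨
      ∑< N G + ifNonZero (suc m) (shiftIf (isDescent p (suc N)) (countWords (L + suc m) (cs ++ [ m ]) (suc N)) 0)
        ≡⟨ countWords-∷ʳ (L + suc m) cs (suc m) p 0 ⟨
      countWords (suc L + suc m) (cs ++ [ suc m ]) p 0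
        ∎
      where
      open ≡-Reasoning
      G : ℕ → ℕ
      G i = ifNonZero (multAt i cs) (shiftIf (isDescent p (suc i)) (countWords (L + suc m) (decAt i cs ++ [ suc m ]) (suc i)) 0)

      term : ∀ i → i < N → ifNonZero (multAt i cs) ((shiftIf (isDescent p (suc i)) (H i) ⋆ insertions (suc L)) (suc m))
                         ≡ G i + ifNonZero (multAt i cs) ((H i ⋆ insertions (suc L)) m)
      term i i<N with multAt i cs in mᵢ≡ | isDescent p (suc i)
      ... | zero  | _     = refl
      ... | suc _ | true  = refl
      ... | suc _ | false = trans (⋆-insertions-suc (H i) L m)
                                  (cong (_+ (H i ⋆ insertions (suc L)) m) (removalIH (suc m) i (IH i) i<N mᵢ≡))

      lastLetter : ifNonZero (suc m) (shiftIf (isDescent p (suc N)) (countWords (L + suc m) (cs ++ [ m ]) (suc N)) 0)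
                   ≡ countWords (suc L + m) (cs ++ [ m ]) 0 0
      lastLetter rewrite isDescent-up p (m≤n⇒m≤1+n p≤N) | +-suc L m =
        countWords-startOutsideX (suc (L + m)) (cs ++ [ m ]) (suc N) 0 new∉X

  countWords-⋆-insertions : ∀ m L cs p → InsertionIdentity m L cs p
  countWords-⋆-insertions m zero cs p Σ≡0 new∉X p≤N =
    trans (⋆-identityˡ (insertions 0) m) (sym (countWords-onlyNewLetter m cs p Σ≡0 new∉X p≤N))
  countWords-⋆-insertions zero (suc L) cs p Σ≡ new∉X p≤N =
    insertion-step-zero Σ≡ new∉X p≤N (λ i → countWords-⋆-insertions zero L (decAt i cs) (suc i))
  countWords-⋆-insertions (suc m) (suc L) cs p Σ≡ new∉X p≤N =
    insertion-step-suc Σ≡ new∉X p≤N m (λ i → countWords-⋆-insertions (suc m) L (decAt i cs) (suc i))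
                                      (countWords-⋆-insertions m (suc L) cs 0)

-- The case X = 2ℕ and ρ = (r, …, r)

twoℕ-+2 : ∀ a → twoℕ (3 + a) ≡ twoℕ (1 + a)
twoℕ-+2 a = cong (_≡ᵇ 0) (trans (cong (_% 2) (+-comm 2 (suc a))) ([m+n]%n≡m%n (suc a) 2))

twoℕ-alternates : ∀ a → twoℕ (2 + a) ≡ not (twoℕ (1 + a))
twoℕ-alternates zero    = refl
twoℕ-alternates (suc a) =
  trans (twoℕ-+2 a) (trans (sym (not-involutive (twoℕ (suc a)))) (cong not (sym (twoℕ-alternates a))))

pairs : ℕ → ℕ → List ℕ
pairs zero    r = []
pairs (suc j) r = r ∷ r ∷ pairs j r

replicate≡pairs : ∀ j r → replicate (2 * j) r ≡ pairs j r
replicate≡pairs zero    r = refl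
replicate≡pairs (suc j) r = trans (cong (λ n → replicate n r) (*-suc 2 j)) (cong (λ l → r ∷ r ∷ l) (replicate≡pairs j r))

sum-pairs : ∀ j r → sum (pairs j r) ≡ r * j + r * j
sum-pairs zero    r rewrite *-zeroʳ r = refl
sum-pairs (suc j) r rewrite sum-pairs j r | *-suc r j =
  solve 2 (λ r x → r :+ (r :+ (x :+ x)) := r :+ x :+ (r :+ x)) refl r (r * j)

twoℕ-after-pairs : ∀ j r → twoℕ (suc (length (pairs j r))) ≡ false
twoℕ-after-pairs zero    r = refl
twoℕ-after-pairs (suc j) r = trans (twoℕ-+2 (length (pairs j r))) (twoℕ-after-pairs j r)

lettersOutsideX-pairs : ∀ o j r m → twoℕ (suc o) ≡ false → lettersOutsideX twoℕ (suc o) (pairs j r ++ [ m ]) ≡ r * j + m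
lettersOutsideX-pairs o zero    r m o∉X rewrite o∉X | *-zeroʳ r = +-identityʳ m
lettersOutsideX-pairs o (suc j) r m o∉X
  rewrite o∉X | twoℕ-alternates o | o∉X | lettersOutsideX-pairs (suc (suc o)) j r m (trans (twoℕ-+2 o) o∉X) | *-suc r j =
  sym (+-assoc r (r * j) m)

-- (r j + m)! / (r!^j m!): the multinomial coefficient with j parts r and one part m.
blockMultinomial : ℕ → ℕ → ℕ → ℕ
blockMultinomial r zero    m = 1
blockMultinomial r (suc j) m = choose (r * suc j + m) r * blockMultinomial r j m

blockMultinomial-split : ∀ r j m → blockMultinomial r j m ≡ blockMultinomial r j 0 * choose (r * j + m) (r * j)
blockMultinomial-split r zero    m rewrite *-zeroʳ r = refl
blockMultinomial-split r (suc j) m rewrite blockMultinomial-split r j m | *-suc r j | +-identityʳ (r + r * j) = begin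
  choose (r + r * j + m) r * (B * choose (r * j + m) (r * j))
    ≡⟨ cong (λ z → choose z r * (B * choose (r * j + m) (r * j))) (+-assoc r (r * j) m) ⟩
  choose (r + (r * j + m)) r * (B * choose (r * j + m) (r * j))
    ≡⟨ solve 3 (λ x b y → x :* (b :* y) := b :* (x :* y)) refl (choose (r + (r * j + m)) r) B (choose (r * j + m) (r * j)) ⟩
  B * (choose (r + (r * j + m)) r * choose (r * j + m) (r * j))
    ≡⟨ cong (B *_) (choose-trinomial (r * j) r m) ⟩
  B * (choose (r + r * j) r * choose (r + r * j + m) (r + r * j))
    ≡⟨ solve 3 (λ x b y → b :* (x :* y) := x :* b :* y) refl (choose (r + r * j) r) B (choose (r + r * j + m) (r + r * j)) ⟩
  choose (r + r * j) r * B * choose (r + r * j + m) (r + r * j)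
    ∎
  where
  open ≡-Reasoning
  B = blockMultinomial r j 0

sum-replicate : ∀ j r → sum (replicate j r) ≡ r * j
sum-replicate zero    r = sym (*-zeroʳ r)
sum-replicate (suc j) r = trans (cong (r +_) (sum-replicate j r)) (sym (*-suc r j))

blockMultinomial-*-factorials : ∀ j r → blockMultinomial r j 0 * product (map _! (replicate j r)) ≡ (sum (replicate j r)) !
blockMultinomial-*-factorials zero    r = refl
blockMultinomial-*-factorials (suc j) r rewrite +-identityʳ (r * suc j) = begin
  choose (r * suc j) r * B * (r ! * F)
    ≡⟨ solve 4 (λ x b u v → x :* b :* (u :* v) := x :* (u :* (b :* v))) refl (choose (r * suc j) r) B (r !) F ⟩
  choose (r * suc j) r * (r ! * (B * F))
    ≡⟨ cong (λ z → choose (r * suc j) r * (r ! * z)) (trans (blockMultinomial-*-factorials j r) (cong _! (sum-replicate j r))) ⟩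
  choose (r * suc j) r * (r ! * (r * j) !)
    ≡⟨ cong (λ z → choose z r * (r ! * (r * j) !)) (*-suc r j) ⟩
  choose (r + r * j) r * (r ! * (r * j) !)
    ≡⟨ choose-*-factorials r (r * j) ⟩
  (r + r * j) !
    ≡⟨ cong (λ z → (r + z) !) (sum-replicate j r) ⟨
  (r + sum (replicate j r)) !
    ∎
  where
  open ≡-Reasoning
  B = blockMultinomial r j 0
  F = product (map _! (replicate j r))

multinomial≡blockMultinomial : ∀ j r → multinomial (replicate j r) ≡ blockMultinomial r j 0
multinomial≡blockMultinomial j r =
  trans (cong (λ z → (z / product (map _! (replicate j r))) {{prod!≢0 (replicate j r)}}) (sym (blockMultinomial-*-factorials j r)))
        (m*n/n≡m (blockMultinomial r j 0) (product (map _! (replicate j r))) {{prod!≢0 (replicate j r)}})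

noDescentCount-pairs : ∀ o j r m → twoℕ (suc o) ≡ false →
  noDescentCount twoℕ (suc o) (pairs j r ++ [ m ]) 0 ≡ blockMultinomial r j m * blockMultinomial r j m
noDescentCount-pairs o zero    r m _ rewrite +-identityʳ m | choose-diag m = refl
noDescentCount-pairs o (suc j) r m o∉X
  rewrite twoℕ-alternates o | o∉X | lettersOutsideX-pairs (suc (suc o)) j r m (trans (twoℕ-+2 o) o∉X)
        | noDescentCount-pairs (suc (suc o)) j r m (trans (twoℕ-+2 o) o∉X)
        | sym (+-assoc r (r * j) m) | sym (*-suc r j) =
  solve 2 (λ c b → c :* (c :* (b :* b)) := c :* b :* (c :* b)) refl (choose (r * suc j + m) r) (blockMultinomial r j m)

-- C(a − 1, s − 1), the number of compositions of a into s parts, including the empty composition of 0.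
compositions : ℕ → ℕ → ℕ
compositions zero    s = choose zero s
compositions (suc a) s = shift (choose a) s

countWords-twoLetters : ∀ n a b s → a + b ≡ n → countWords twoℕ n (a ∷ b ∷ []) 0 s ≡ choose a s * choose b s
countWords-twoLetters-after2 : ∀ n a b s → a + b ≡ n → countWords twoℕ n (a ∷ b ∷ []) 2 s ≡ compositions a s * choose (suc b) s

countWords-twoLetters zero zero zero zero    _ = refl
countWords-twoLetters zero zero zero (suc s) _ = refl
countWords-twoLetters (suc n) zero (suc b) s eq =
  trans (+-identityʳ _) (countWords-twoLetters-after2 n 0 b s (suc-injective eq))
countWords-twoLetters (suc n) (suc a) zero s eq
  rewrite +-identityʳ (countWords twoℕ n (a ∷ 0 ∷ []) 1 s) | countWords-startOutsideX twoℕ n (a ∷ 0 ∷ []) 1 s refl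
        | countWords-twoLetters n a 0 s (suc-injective eq) with s
... | zero   = refl
... | suc s′ = trans (*-zeroʳ (choose a (suc s′))) (sym (*-zeroʳ (choose (suc a) (suc s′))))
countWords-twoLetters (suc n) (suc a) (suc b) s eq
  rewrite countWords-startOutsideX twoℕ n (a ∷ suc b ∷ []) 1 s refl
        | countWords-twoLetters n a (suc b) s (suc-injective eq)
        | countWords-twoLetters-after2 n (suc a) b s (trans (sym (+-suc a b)) (suc-injective eq))
        | +-identityʳ (compositions (suc a) s * choose (suc b) s) with s
... | zero   = refl
... | suc s′ = trans (+-comm (choose a (suc s′) * choose (suc b) (suc s′)) _)
                     (sym (*-distribʳ-+ (choose (suc b) (suc s′)) (choose a s′) (choose a (suc s′))))

countWords-twoLetters-after2 zero zero zero zero    _ = refl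
countWords-twoLetters-after2 zero zero zero (suc s) _ = refl
countWords-twoLetters-after2 (suc n) zero (suc b) s eq
  rewrite +-identityʳ (countWords twoℕ n (0 ∷ b ∷ []) 2 s) | countWords-twoLetters-after2 n 0 b s (suc-injective eq) with s
... | zero   = refl
... | suc _  = refl
countWords-twoLetters-after2 (suc n) (suc a) zero zero    _ = refl
countWords-twoLetters-after2 (suc n) (suc a) zero (suc s) eq
  rewrite +-identityʳ (countWords twoℕ n (a ∷ 0 ∷ []) 1 s) | countWords-startOutsideX twoℕ n (a ∷ 0 ∷ []) 1 s refl
        | countWords-twoLetters n a 0 s (suc-injective eq) | +-identityʳ (choose 0 s) = refl
countWords-twoLetters-after2 (suc n) (suc a) (suc b) zero eq
  rewrite countWords-twoLetters-after2 n (suc a) b 0 (trans (sym (+-suc a b)) (suc-injective eq)) = refl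
countWords-twoLetters-after2 (suc n) (suc a) (suc b) (suc s) eq
  rewrite countWords-startOutsideX twoℕ n (a ∷ suc b ∷ []) 1 s refl
        | countWords-twoLetters n a (suc b) s (suc-injective eq)
        | countWords-twoLetters-after2 n (suc a) b (suc s) (trans (sym (+-suc a b)) (suc-injective eq))
        | +-identityʳ (choose a s * choose (suc b) (suc s)) =
  sym (*-distribˡ-+ (choose a s) (choose (suc b) s) (choose (suc b) (suc s)))

pairs-⋆-insertions : ∀ j r m → (countWords twoℕ (sum (pairs j r)) (pairs j r) 0 ⋆ insertions (sum (pairs j r))) m
                     ≡ (blockMultinomial r j 0 * blockMultinomial r j 0) * (choose (r * j + m) (r * j) * choose (r * j + m) (r * j))
pairs-⋆-insertions j r m = begin
  (countWords twoℕ L (pairs j r) 0 ⋆ insertions L) m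
    ≡⟨ countWords-⋆-insertions twoℕ m L (pairs j r) 0 refl (twoℕ-after-pairs j r) z≤n ⟩
  countWords twoℕ (L + m) (pairs j r ++ [ m ]) 0 0
    ≡⟨ countWords≡noDescentCount twoℕ (L + m) (pairs j r ++ [ m ]) 0
                                 (trans (sum-++ (pairs j r) [ m ]) (cong (L +_) (+-identityʳ m))) ⟩
  noDescentCount twoℕ 1 (pairs j r ++ [ m ]) 0
    ≡⟨ noDescentCount-pairs 0 j r m refl ⟩
  blockMultinomial r j m * blockMultinomial r j m
    ≡⟨ cong (λ b → b * b) (blockMultinomial-split r j m) ⟩
  (B * C) * (B * C)
    ≡⟨ solve 2 (λ b c → b :* c :* (b :* c) := b :* b :* (c :* c)) refl B C ⟩
  (B * B) * (C * C)
    ∎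
  where
  open ≡-Reasoning
  L = sum (pairs j r)
  B = blockMultinomial r j 0
  C = choose (r * j + m) (r * j)

twoLetters-⋆-insertions : ∀ A m → (countWords twoℕ (A + A) (A ∷ A ∷ []) 0 ⋆ insertions (A + A)) m
                                  ≡ choose (A + m) A * choose (A + m) A
twoLetters-⋆-insertions A m
  with pairs-⋆-insertions 1 A m
... | eq rewrite +-identityʳ A | *-identityʳ A | +-identityʳ A | choose-diag A = trans eq (+-identityʳ _)

countWords-pairs : ∀ j r s → countWords twoℕ (sum (pairs j r)) (pairs j r) 0 s
                   ≡ (blockMultinomial r j 0 * blockMultinomial r j 0) * (choose (r * j) s * choose (r * j) s)
countWords-pairs j r s =
  trans (⋆-cancelʳ (countWords twoℕ L (pairs j r) 0) g (insertions L) (insertions-zero L) same-⋆ s)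
        (cong (B² *_) (countWords-twoLetters (A + A) A A s refl))
  where
  L = sum (pairs j r)
  A = r * j
  B² = blockMultinomial r j 0 * blockMultinomial r j 0
  g : ℕ → ℕ
  g s = B² * countWords twoℕ (A + A) (A ∷ A ∷ []) 0 s
  same-⋆ : ∀ m → (countWords twoℕ L (pairs j r) 0 ⋆ insertions L) m ≡ (g ⋆ insertions L) m
  same-⋆ m = begin
    (countWords twoℕ L (pairs j r) 0 ⋆ insertions L) m
      ≡⟨ pairs-⋆-insertions j r m ⟩
    B² * (choose (A + m) A * choose (A + m) A)
      ≡⟨ cong (B² *_) (twoLetters-⋆-insertions A m) ⟨
    B² * (countWords twoℕ (A + A) (A ∷ A ∷ []) 0 ⋆ insertions (A + A)) m
      ≡⟨ cong (λ n → B² * (countWords twoℕ (A + A) (A ∷ A ∷ []) 0 ⋆ insertions n) m) (sum-pairs j r) ⟨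
    B² * (countWords twoℕ (A + A) (A ∷ A ∷ []) 0 ⋆ insertions L) m
      ≡⟨ ⋆-*ˡ B² (countWords twoℕ (A + A) (A ∷ A ∷ []) 0) (insertions L) m ⟨
    (g ⋆ insertions L) m
      ∎
    where open ≡-Reasoning

corollary5p5 : (k n s : ℕ) → P (replicate (2 * suc n) (suc k)) s twoℕ ≡ (multinomial (replicate (suc n) (suc k)) ^ 2) * ((suc k * suc n) C s) ^ 2
corollary5p5 k n s = begin
  P ρ s twoℕ
    ≡⟨ P≡countWords twoℕ ρ s ⟩
  countWords twoℕ (sum ρ) ρ 0 s
    ≡⟨ cong (λ cs → countWords twoℕ (sum cs) cs 0 s) (replicate≡pairs (suc n) (suc k)) ⟩
  countWords twoℕ (sum (pairs (suc n) (suc k))) (pairs (suc n) (suc k)) 0 s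
    ≡⟨ countWords-pairs (suc n) (suc k) s ⟩
  (B * B) * (choose (suc k * suc n) s * choose (suc k * suc n) s)
    ≡⟨ cong₂ (λ b c → (b * b) * (c * c)) (sym (multinomial≡blockMultinomial (suc n) (suc k))) (choose≡C (suc k * suc n) s) ⟩
  (M * M) * (D * D)
    ≡⟨ cong₂ _*_ (square M) (square D) ⟨
  M ^ 2 * D ^ 2
    ∎
  where
  open ≡-Reasoning
  ρ = replicate (2 * suc n) (suc k)
  B = blockMultinomial (suc k) (suc n) 0
  M = multinomial (replicate (suc n) (suc k))
  D = (suc k * suc n) C s
  square : ∀ x → x ^ 2 ≡ x * x
  square x = cong (x *_) (*-identityʳ x)
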